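{- Let $\Delta$ be a simplicial complex of dimension at most $d$, and let $\mathcal{A}\subseteq\mathbb{N}$ be a finite set with $d\notin\mathcal{A}$. If $\Gamma$ is the $\mathcal{A}$-facet-free reduction of $\Delta$, then $\beta_{d}(\Gamma) = \beta_{d}(\Delta)$.
   Context: For a simplicial complex $\Delta$, $\mathcal{F}_k(\Delta)$ denotes its set of $k$-dimensional faces and $\mathrm{Facet}(\Delta)$ its set of facets (maximal faces). For a finite set $\mathcal{A}=\{a_1,\dots,a_r\}\subseteq\mathbb{N}$ with $a_1>\dots>a_r$, set $\Gamma_0=\Delta$ and iteratively $\Gamma_i=\Gamma_{i-1}\setminus(\mathcal{F}_{a_i}(\Gamma_{i-1})\cap\mathrm{Facet}(\Gamma_{i-1}))$ for $i=1,\dots,r$; the final complex $\Gamma_r$ is the $\mathcal{A}$-facet-free reduction of $\Delta$. Fix a field $\Bbbk$; $\beta_d=\dim_\Bbbk\widetilde H_d(\,\cdot\,;\Bbbk)$. -}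

module Defs where

open import Level using (Level; _⊔_) renaming (suc to lsuc)
open import Data.Nat using (ℕ; zero; suc; _≤_; _>_)
open import Data.Fin using (Fin) renaming (_<?_ to _<ᶠ?_)
open import Data.Fin.Subset using (Subset; ∣_∣; _∪_; _∩_; ⁅_⁆)
open import Data.Fin.Subset.Properties using (_∈?_; _⊂?_; anySubset?)
open import Data.Bool using (Bool; true; false; _∧_; not; if_then_else_; T)
open import Data.List using (List; []; _∷_)
open import Data.Vec using (tabulate)
open import Data.Product using (Σ; ∃; _×_)
open import Relation.Nullary using (¬_; Dec; does)
open import Relation.Nullary.Decidable using (_×-dec_; T?)
open import Relation.Binary.PropositionalEquality using (_≡_)
open import Data.Nat using (_≡ᵇ_)
open import Algebra.Bundles using (CommutativeRing)

record Field (c ℓ : Level) : Set (lsuc (c ⊔ ℓ)) where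
  field
    commutativeRing : CommutativeRing c ℓ
  open CommutativeRing commutativeRing public
  field
    0#≉1# : ¬ (0# ≈ 1#)
    inverse : ∀ x → ¬ (x ≈ 0#) → ∃ λ y → (x * y) ≈ 1#

-- Simplicial complexes on the (finite) vertex set Fin n.
-- A face is a subset of Fin n; a "complex" is given by its (decidable)
-- face-membership predicate. Dimension of a face σ is ∣ σ ∣ - 1.

Complex : ℕ → Set
Complex n = Subset n → Bool

module _ {n : ℕ} where

  Face : Complex n → Subset n → Set
  Face Δ σ = T (Δ σ)

  IsSimplicialComplex : Complex n → Set
  IsSimplicialComplex Δ = ∀ σ τ → τ Data.Fin.Subset.⊆ σ → Face Δ σ → Face Δ τ

  DimAtMost : Complex n → ℕ → Set
  DimAtMost Δ d = ∀ σ → Face Δ σ → ∣ σ ∣ ≤ suc d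

  isFacet : Complex n → Subset n → Bool
  isFacet Δ σ = Δ σ ∧ not (does (anySubset? (λ τ → (σ ⊂? τ) ×-dec T? (Δ τ))))

  hasDim : ℕ → Subset n → Bool
  hasDim k σ = ∣ σ ∣ ≡ᵇ suc k

  removeFacetsOfDim : ℕ → Complex n → Complex n
  removeFacetsOfDim a Δ σ = Δ σ ∧ not (hasDim a σ ∧ isFacet Δ σ)

  -- iterate over the list a₁, …, a_r in the given order
  -- (the statement requires the list to be strictly decreasing)
  facetFreeReduction : List ℕ → Complex n → Complex n
  facetFreeReduction []      Δ = Δ
  facetFreeReduction (a ∷ A) Δ = facetFreeReduction A (removeFacetsOfDim a Δ)

-- Chains are functions Subset n → K; a k-chain of Δ is supported on the
-- k-dimensional faces of Δ (k = -1 corresponds to ∅, giving the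
-- augmented/reduced chain complex). Orientation: faces ordered by the
-- order of Fin n.

module Homology {c ℓ : Level} (K : Field c ℓ) {n : ℕ} where
  open Field K
  open import Algebra.Definitions.RawMonoid +-rawMonoid using (sum)

  Chain : Set c
  Chain = Subset n → Carrier

  IsChain : Complex n → ℕ → Chain → Set ℓ
  IsChain Δ k ch = ∀ σ → ¬ (Face Δ σ × ∣ σ ∣ ≡ suc k) → ch σ ≈ 0#

  sgn : ℕ → Carrier
  sgn zero    = 1#
  sgn (suc k) = - sgn k

  below : Fin n → Subset n
  below v = tabulate (λ u → does (u <ᶠ? v))

  -- simplicial boundary: ∂[w₀ < … < w_k] = Σᵢ (-1)ⁱ [w₀ … ŵᵢ … w_k]
  ∂ : Chain → Chain
  ∂ ch τ = sum (λ v → if does (v ∈? τ) then 0#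
                      else (sgn ∣ τ ∩ below v ∣ * ch (τ ∪ ⁅ v ⁆)))

  IsCycle : Complex n → ℕ → Chain → Set ℓ
  IsCycle Δ d z = IsChain Δ d z × (∀ τ → ∂ z τ ≈ 0#)

  IsBoundary : Complex n → ℕ → Chain → Set (c ⊔ ℓ)
  IsBoundary Δ d z = ∃ λ b → IsChain Δ (suc d) b × (∀ σ → z σ ≈ ∂ b σ)

  lincomb : {m : ℕ} → (Fin m → Carrier) → (Fin m → Chain) → Chain
  lincomb λs zs σ = sum (λ i → λs i * zs i σ)

  _-ᶜ_ : Chain → Chain → Chain
  (x -ᶜ y) σ = x σ - y σ

  -- β_d(Δ) = m : dim_K H̃_d(Δ; K) = m, i.e. there are m d-cycles whose
  -- classes form a basis of Z_d / B_d.
  Betti : Complex n → ℕ → ℕ → Set (c ⊔ ℓ)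
  Betti Δ d m = Σ (Fin m → Chain) λ zs →
      (∀ i → IsCycle Δ d (zs i))
    × (∀ λs → IsBoundary Δ d (lincomb λs zs) → ∀ i → λs i ≈ 0#)
    × (∀ y → IsCycle Δ d y → ∃ λ λs → IsBoundary Δ d (y -ᶜ lincomb λs zs))

-- Reduced homology in degree d depends only on the d- and (d+1)-dimensional faces.
-- The reduction only deletes faces, and only of dimensions in A, so it keeps every
-- d-face; and a complex of dimension at most d has no (d+1)-faces at all.

module Submission where

open import Defs
open import Level using (Level)
open import Data.Nat using (ℕ; suc; _>_; _≤_)
open import Data.Nat.Properties using (≡ᵇ⇒≡; suc-injective; 1+n≰n)
open import Data.List using (List; []; _∷_)
open import Data.List.Membership.Propositional using (_∉_)
open import Data.List.Relation.Unary.Any using (here; there)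
open import Data.List.Relation.Unary.Linked using (Linked)
open import Data.Fin.Subset using (Subset; ∣_∣)
open import Data.Bool using (true; false; T; _∧_)
open import Data.Bool.Properties using (T-∧; T-not-≡)
open import Data.Product using (_,_; proj₁)
open import Data.Empty using (⊥-elim)
open import Function.Bundles using (_⇔_; mk⇔; Equivalence)
open import Function.Properties.Equivalence using () renaming (sym to ⇔-sym)
open import Relation.Nullary using (¬_; contradiction)
open import Relation.Binary.PropositionalEquality using (_≡_; _≢_; refl; sym; trans; cong; subst)

open Equivalence using (to; from)

module _ {n : ℕ} where

  SameFacesOfDim : Complex n → Complex n → ℕ → Set
  SameFacesOfDim Δ₁ Δ₂ k = ∀ σ → ∣ σ ∣ ≡ suc k → Face Δ₁ σ ⇔ Face Δ₂ σ

  SameFacesOfDim-sym : ∀ {Δ₁ Δ₂ : Complex n} {k} → SameFacesOfDim Δ₁ Δ₂ k → SameFacesOfDim Δ₂ Δ₁ k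
  SameFacesOfDim-sym same σ ∣σ∣≡ = ⇔-sym (same σ ∣σ∣≡)

  hasDim-false : ∀ {a d} (σ : Subset n) → ∣ σ ∣ ≡ suc d → a ≢ d → hasDim a σ ≡ false
  hasDim-false {a} σ ∣σ∣≡ a≢d with hasDim a σ in eq
  ... | false = refl
  ... | true  = contradiction
    (suc-injective (trans (sym (≡ᵇ⇒≡ ∣ σ ∣ (suc a) (subst T (sym eq) _))) ∣σ∣≡)) a≢d

  removeFacetsOfDim-⊆ : ∀ a (Δ : Complex n) σ → Face (removeFacetsOfDim a Δ) σ → Face Δ σ
  removeFacetsOfDim-⊆ a Δ σ f = proj₁ (to T-∧ f)

  removeFacetsOfDim-keeps : ∀ {a d} (Δ : Complex n) σ → ∣ σ ∣ ≡ suc d → a ≢ d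
    → Face Δ σ → Face (removeFacetsOfDim a Δ) σ
  removeFacetsOfDim-keeps Δ σ ∣σ∣≡ a≢d f =
    from T-∧ (f , from T-not-≡ (cong (_∧ isFacet Δ σ) (hasDim-false σ ∣σ∣≡ a≢d)))

  facetFreeReduction-⊆ : ∀ A (Δ : Complex n) σ → Face (facetFreeReduction A Δ) σ → Face Δ σ
  facetFreeReduction-⊆ []      Δ σ f = f
  facetFreeReduction-⊆ (a ∷ A) Δ σ f =
    removeFacetsOfDim-⊆ a Δ σ (facetFreeReduction-⊆ A (removeFacetsOfDim a Δ) σ f)

  facetFreeReduction-keeps : ∀ {d} A (Δ : Complex n) σ → d ∉ A → ∣ σ ∣ ≡ suc d
    → Face Δ σ → Face (facetFreeReduction A Δ) σ
  facetFreeReduction-keeps []      Δ σ d∉A ∣σ∣≡ f = f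
  facetFreeReduction-keeps (a ∷ A) Δ σ d∉A ∣σ∣≡ f =
    facetFreeReduction-keeps A (removeFacetsOfDim a Δ) σ (λ d∈A → d∉A (there d∈A)) ∣σ∣≡
      (removeFacetsOfDim-keeps Δ σ ∣σ∣≡ (λ a≡d → d∉A (here (sym a≡d))) f)

  facetFreeReduction-sameFacesOfDim : ∀ {d} A (Δ : Complex n) → d ∉ A
    → SameFacesOfDim (facetFreeReduction A Δ) Δ d
  facetFreeReduction-sameFacesOfDim A Δ d∉A σ ∣σ∣≡ =
    mk⇔ (facetFreeReduction-⊆ A Δ σ) (facetFreeReduction-keeps A Δ σ d∉A ∣σ∣≡)

  DimAtMost-noFacesAbove : ∀ {Δ : Complex n} {d} → DimAtMost Δ d → ∀ σ → ∣ σ ∣ ≡ suc (suc d) → ¬ Face Δ σ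
  DimAtMost-noFacesAbove dim σ ∣σ∣≡ f = 1+n≰n (subst (_≤ _) ∣σ∣≡ (dim σ f))

  DimAtMost-sameFacesAbove : ∀ {Δ₁ Δ₂ : Complex n} {d} → DimAtMost Δ₁ d → DimAtMost Δ₂ d
    → SameFacesOfDim Δ₁ Δ₂ (suc d)
  DimAtMost-sameFacesAbove dim₁ dim₂ σ ∣σ∣≡ =
    mk⇔ (λ f → ⊥-elim (DimAtMost-noFacesAbove dim₁ σ ∣σ∣≡ f))
        (λ f → ⊥-elim (DimAtMost-noFacesAbove dim₂ σ ∣σ∣≡ f))

  facetFreeReduction-dimAtMost : ∀ {d} A (Δ : Complex n) → DimAtMost Δ d → DimAtMost (facetFreeReduction A Δ) d
  facetFreeReduction-dimAtMost A Δ dim σ f = dim σ (facetFreeReduction-⊆ A Δ σ f)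

module _ {c ℓ : Level} (K : Field c ℓ) {n : ℕ} where
  open Homology K {n}

  IsChain-transfer : ∀ {Δ₁ Δ₂ : Complex n} {k ch} → SameFacesOfDim Δ₁ Δ₂ k → IsChain Δ₁ k ch → IsChain Δ₂ k ch
  IsChain-transfer same chain σ ¬face = chain σ λ (f , ∣σ∣≡) → ¬face (to (same σ ∣σ∣≡) f , ∣σ∣≡)

  Betti-transfer : ∀ {Δ₁ Δ₂ : Complex n} {d m} → SameFacesOfDim Δ₁ Δ₂ d → SameFacesOfDim Δ₁ Δ₂ (suc d)
    → Betti Δ₁ d m → Betti Δ₂ d m
  Betti-transfer sameᵈ sameᵈ⁺¹ (zs , cycles , independent , spanning) =
      zs
    , (λ i → let (chain , closed) = cycles i in IsChain-transfer sameᵈ chain , closed)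
    , (λ λs (b , chain , eq) → independent λs (b , IsChain-transfer (SameFacesOfDim-sym sameᵈ⁺¹) chain , eq))
    , λ y (chain , closed) →
        let (λs , b , bChain , eq) = spanning y (IsChain-transfer (SameFacesOfDim-sym sameᵈ) chain , closed)
        in λs , b , IsChain-transfer sameᵈ⁺¹ bChain , eq

  Betti-cong : ∀ {Δ₁ Δ₂ : Complex n} {d m} → SameFacesOfDim Δ₁ Δ₂ d → SameFacesOfDim Δ₁ Δ₂ (suc d)
    → Betti Δ₁ d m ⇔ Betti Δ₂ d m
  Betti-cong sameᵈ sameᵈ⁺¹ =
    mk⇔ (Betti-transfer sameᵈ sameᵈ⁺¹)
        (Betti-transfer (SameFacesOfDim-sym sameᵈ) (SameFacesOfDim-sym sameᵈ⁺¹))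

corollary3p4 : {c ℓ : Level} (K : Field c ℓ) (n : ℕ) (Δ : Complex n) (d : ℕ)
    → IsSimplicialComplex Δ
    → DimAtMost Δ d
    → (A : List ℕ) → Linked _>_ A → d ∉ A
    → ∀ m → Homology.Betti K (facetFreeReduction A Δ) d m ⇔ Homology.Betti K Δ d m
corollary3p4 K n Δ d _ dim A _ d∉A m =
  Betti-cong K
    (facetFreeReduction-sameFacesOfDim A Δ d∉A)
    (DimAtMost-sameFacesAbove (facetFreeReduction-dimAtMost A Δ dim) dim)
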